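{- Let $n\ge 2$ be an integer. Then every $\mathbb{Z}/n$-equivariant simplicial map $f\colon\Delta_{n,2n-1}\to\Delta_{n-1}$ is surjective (as a map of geometric realizations).
   Context: The chessboard complex $\Delta_{m,n}$ is the simplicial complex on vertex set $[m]\times[n]$ whose faces are the sets in which any two distinct elements differ in both coordinates. For $\Delta_{n,2n-1}$ the row set is identified with $\mathbb{Z}/n$ and $\mathbb{Z}/n$ acts by $j\cdot(i,\ell)=(i+j,\ell)$. $\Delta_{n-1}$ is the simplex with vertex set $\mathbb{Z}/n$, with $\mathbb{Z}/n$ acting by $k\mapsto k+j$ on vertices. A simplicial map sends vertices to vertices and faces into faces, and is extended to geometric realizations by linear interpolation.
   Formalization: The geometric realizations of $\Delta_{n,2n-1}$ and $\Delta_{n-1}$ are replaced by their sets of points with rational barycentric coordinates. -}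

module Defs where

open import Data.Nat using (ℕ; zero; suc; _*_; _∸_)
open import Data.Nat.DivMod using (_mod_)
open import Data.Fin using (Fin; toℕ)
import Data.Fin as F
open import Data.Nat as N using ()
open import Data.Product using (_×_; _,_; proj₁; proj₂; Σ; ∃)
open import Data.List using (List; map)
open import Data.List.Membership.Propositional using (_∈_)
open import Data.Unit using (⊤)
open import Data.Bool using (if_then_else_)
open import Relation.Nullary using (¬_; does)
open import Relation.Binary.PropositionalEquality using (_≡_; _≢_)
open import Data.Rational using (ℚ; 0ℚ; 1ℚ; _+_; _≤_)

-- ℤ/n modelled as Fin n, with addition modulo n.

_+ₙ_ : {n : ℕ} → Fin n → Fin n → Fin n
_+ₙ_ {suc k} i j = (toℕ i N.+ toℕ j) mod suc k

-- The chessboard complex Δ_{n,2n-1}: vertices [n] × [2n-1]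
-- (rows = ℤ/n as Fin n, columns Fin (2n-1)).

Cols : ℕ → ℕ
Cols n = 2 * n ∸ 1

ChessVertex : ℕ → Set
ChessVertex n = Fin n × Fin (Cols n)

IsChessFace : {n : ℕ} → List (ChessVertex n) → Set
IsChessFace σ = ∀ {u v} → u ∈ σ → v ∈ σ → u ≢ v →
  (proj₁ u ≢ proj₁ v) × (proj₂ u ≢ proj₂ v)

IsSimplexFace : {n : ℕ} → List (Fin n) → Set
IsSimplexFace _ = ⊤

actChess : {n : ℕ} → Fin n → ChessVertex n → ChessVertex n
actChess j (i , ℓ) = (i +ₙ j , ℓ)

actSimplex : {n : ℕ} → Fin n → Fin n → Fin n
actSimplex j k = k +ₙ j

IsSimplicial : {n : ℕ} → (ChessVertex n → Fin n) → Set
IsSimplicial {n} f = (σ : List (ChessVertex n)) → IsChessFace σ → IsSimplexFace (map f σ)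

IsEquivariant : {n : ℕ} → (ChessVertex n → Fin n) → Set
IsEquivariant {n} f = (j : Fin n) (v : ChessVertex n) → f (actChess j v) ≡ actSimplex j (f v)

sumFin : {k : ℕ} → (Fin k → ℚ) → ℚ
sumFin {zero} w = 0ℚ
sumFin {suc k} w = w F.zero + sumFin (λ i → w (F.suc i))

sumChess : {n : ℕ} → (ChessVertex n → ℚ) → ℚ
sumChess w = sumFin (λ i → sumFin (λ ℓ → w (i , ℓ)))

record ChessPoint (n : ℕ) : Set where
  field
    coord   : ChessVertex n → ℚ
    nonneg  : ∀ v → 0ℚ ≤ coord v
    sum1    : sumChess coord ≡ 1ℚ
    carrier : List (ChessVertex n)
    face    : IsChessFace carrier
    support : ∀ v → ¬ (coord v ≡ 0ℚ) → v ∈ carrier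

record SimplexPoint (n : ℕ) : Set where
  field
    coord  : Fin n → ℚ
    nonneg : ∀ k → 0ℚ ≤ coord k
    sum1   : sumFin coord ≡ 1ℚ

-- linear extension |f| of a vertex map, on barycentric coordinates:
-- the k-th coordinate of |f|(x) is the sum of x_v over v with f v = k
realize : {n : ℕ} → (ChessVertex n → Fin n) → (ChessVertex n → ℚ) → Fin n → ℚ
realize f x k = sumChess (λ v → if does (f v F.≟ k) then x v else 0ℚ)

IsSurjectiveRealization : {n : ℕ} → (ChessVertex n → Fin n) → Set
IsSurjectiveRealization {n} f =
  (y : SimplexPoint n) → Σ (ChessPoint n) λ x →
    ∀ k → realize f (ChessPoint.coord x) k ≡ SimplexPoint.coord y k

-- Equivariance forces f (r , c) = f (0 , c) + r, so in every column c each colour k ∈ ℤ/n is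
-- taken by exactly one row G c k.  The 2n − 1 columns thus give 2n − 1 matchings of the n colours
-- into the n rows, and Drisko's theorem on rainbow matchings provides distinct columns c_k with
-- the rows G c_k k pairwise distinct.  The vertices τ k = (G c_k k , c_k) are a non-attacking
-- rook placement, i.e. a face, with f (τ k) = k, so the point with barycentric coordinate y_k at
-- τ k is mapped to y.
module Submission where

open import Defs
open import Data.Nat using (ℕ; _≤_)
open import Data.Fin using (Fin)
open import Data.Nat using (zero; suc; _+_; _∸_; _<_; z≤n; s≤s⁻¹; NonZero)
open import Data.Nat.Properties
  using (≤-<-trans; ≤-reflexive; +-monoˡ-≤; m≤n+m; +-suc; +-assoc; +-identityʳ; n<1+n; <⇒≤; <⇒≱;
         m≤n⇒m≤1+n; m+[n∸m]≡n; suc-injective)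
open import Data.Nat.DivMod using (_%_; _mod_; %-distribˡ-+; m%n%n≡m%n; m<n⇒m%n≡m; %-remove-+ˡ)
open import Data.Nat.Divisibility using (∣-refl)
open import Data.Fin using (zero; suc; toℕ; fromℕ<; punchIn; _≟_)
open import Data.Fin.Properties
  using (toℕ-injective; toℕ-fromℕ<; toℕ<n; punchInᵢ≢i; any?; all?; injective⇒≤; <⇒notInjective)
  renaming (suc-injective to Fin-suc-injective)
open import Data.Rational using (ℚ; 0ℚ)
import Data.Rational as ℚ
import Data.Rational.Properties as ℚₚ
open import Algebra.Properties.CommutativeMonoid.Sum ℚₚ.+-0-commutativeMonoid
  using (sum; sum-cong-≗; sum-replicate-zero; sum-remove; ∑-comm)
open import Data.Bool using (if_then_else_)
open import Data.List using (List; map; allFin)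
open import Data.List.Membership.Propositional using (_∈_)
open import Data.List.Membership.Propositional.Properties using (∈-map⁺; ∈-map⁻; ∈-allFin)
open import Data.Vec.Functional using (_∷_; updateAt)
open import Data.Vec.Functional.Properties using (updateAt-updates; updateAt-minimal)
open import Data.Product using (∃; _,_; proj₁; proj₂)
open import Data.Product.Properties using (≡-dec)
open import Data.Sum using (_⊎_; inj₁; inj₂)
open import Data.Empty using (⊥-elim)
open import Function using (_∘_; id; const; Injective)
open import Relation.Nullary using (Dec; does; yes; no; ¬_)
open import Relation.Nullary.Decidable using (¬?)
open import Relation.Nullary.Negation using (contradiction)
open import Relation.Binary.PropositionalEquality

private variable
  A : Set
  a b t K : ℕ

sumFin≡sum : (w : Fin K → ℚ) → sumFin w ≡ sum w
sumFin≡sum {zero}  w = refl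
sumFin≡sum {suc K} w = cong (w zero ℚ.+_) (sumFin≡sum (w ∘ suc))

sumFin-cong : {v w : Fin K → ℚ} → (∀ i → v i ≡ w i) → sumFin v ≡ sumFin w
sumFin-cong {v = v} {w} v≗w = trans (sumFin≡sum v) (trans (sum-cong-≗ v≗w) (sym (sumFin≡sum w)))

sumFin-zero : {w : Fin K → ℚ} → (∀ i → w i ≡ 0ℚ) → sumFin w ≡ 0ℚ
sumFin-zero {K} w≗0 = trans (sumFin-cong w≗0) (trans (sumFin≡sum {K} (const 0ℚ)) (sum-replicate-zero K))

sumFin-single : (w : Fin K → ℚ) (i : Fin K) → (∀ j → j ≢ i → w j ≡ 0ℚ) → sumFin w ≡ w i
sumFin-single {suc K} w i w≗0 = begin
  sumFin w                              ≡⟨ sumFin≡sum w ⟩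
  sum w                                 ≡⟨ sum-remove w ⟩
  w i ℚ.+ sum (w ∘ punchIn i)           ≡⟨ cong (w i ℚ.+_) (sumFin≡sum (w ∘ punchIn i)) ⟨
  w i ℚ.+ sumFin (w ∘ punchIn i)        ≡⟨ cong (w i ℚ.+_) (sumFin-zero (λ j → w≗0 (punchIn i j) (punchInᵢ≢i i j))) ⟩
  w i ℚ.+ 0ℚ                            ≡⟨ ℚₚ.+-identityʳ (w i) ⟩
  w i                                   ∎
  where open ≡-Reasoning

sumFin-δ : (i : Fin K) (x : ℚ) → sumFin (λ j → if does (i ≟ j) then x else 0ℚ) ≡ x
sumFin-δ i x = trans (sumFin-single _ i off) at
  where
  off : ∀ j → j ≢ i → (if does (i ≟ j) then x else 0ℚ) ≡ 0ℚ
  off j j≢i with i ≟ j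
  ... | yes i≡j = contradiction (sym i≡j) j≢i
  ... | no  _   = refl
  at : (if does (i ≟ i) then x else 0ℚ) ≡ x
  at with i ≟ i
  ... | yes _   = refl
  ... | no  i≢i = contradiction refl i≢i

sumFin-comm : ∀ {L} (w : Fin K → Fin L → ℚ) →
  sumFin (λ i → sumFin (λ j → w i j)) ≡ sumFin (λ j → sumFin (λ i → w i j))
sumFin-comm w = begin
  sumFin (λ i → sumFin (w i))            ≡⟨ sumFin-cong (λ i → sumFin≡sum (w i)) ⟩
  sumFin (λ i → sum (w i))               ≡⟨ sumFin≡sum (λ i → sum (w i)) ⟩
  sum (λ i → sum (w i))                  ≡⟨ ∑-comm w ⟩
  sum (λ j → sum (λ i → w i j))          ≡⟨ sumFin≡sum (λ j → sum (λ i → w i j)) ⟨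
  sumFin (λ j → sum (λ i → w i j))       ≡⟨ sumFin-cong (λ j → sumFin≡sum (λ i → w i j)) ⟨
  sumFin (λ j → sumFin (λ i → w i j))    ∎
  where open ≡-Reasoning

sumFin-nonneg : (w : Fin K → ℚ) → (∀ i → 0ℚ ℚ.≤ w i) → 0ℚ ℚ.≤ sumFin w
sumFin-nonneg {zero}  w w≥0 = ℚₚ.≤-refl
sumFin-nonneg {suc K} w w≥0 = subst (ℚ._≤ sumFin w) (ℚₚ.+-identityˡ 0ℚ)
  (ℚₚ.+-mono-≤ (w≥0 zero) (sumFin-nonneg (w ∘ suc) (w≥0 ∘ suc)))

sumChess-single : ∀ {n} (w : ChessVertex n → ℚ) v → (∀ u → u ≢ v → w u ≡ 0ℚ) → sumChess w ≡ w v
sumChess-single w (i , ℓ) w≗0 =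
  trans (sumFin-single _ i (λ i′ i′≢i → sumFin-zero (λ ℓ′ → w≗0 (i′ , ℓ′) (i′≢i ∘ cong proj₁))))
        (sumFin-single _ ℓ (λ ℓ′ ℓ′≢ℓ → w≗0 (i , ℓ′) (ℓ′≢ℓ ∘ cong proj₂)))

sumFin-realize : ∀ {n} (f : ChessVertex n → Fin n) (x : ChessVertex n → ℚ) →
  sumFin (realize f x) ≡ sumChess x
sumFin-realize f x = begin
  sumFin (λ k → sumFin (λ i → sumFin (λ ℓ → δ k (i , ℓ))))  ≡⟨ sumFin-comm (λ k i → sumFin (λ ℓ → δ k (i , ℓ))) ⟩
  sumFin (λ i → sumFin (λ k → sumFin (λ ℓ → δ k (i , ℓ))))  ≡⟨ sumFin-cong (λ i → sumFin-comm (λ k ℓ → δ k (i , ℓ))) ⟩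
  sumChess (λ v → sumFin (λ k → δ k v))                      ≡⟨ sumFin-cong (λ i → sumFin-cong (λ ℓ → sumFin-δ (f (i , ℓ)) (x (i , ℓ)))) ⟩
  sumChess x                                                 ∎
  where
  open ≡-Reasoning
  δ : Fin _ → ChessVertex _ → ℚ
  δ k v = if does (f v ≟ k) then x v else 0ℚ

_-ₙ_ : ∀ {n} → Fin n → Fin n → Fin n
_-ₙ_ {suc n} k a = (suc n ∸ toℕ a + toℕ k) mod suc n

[m+n%d]%d≡[m+n]%d : ∀ m n d → .{{_ : NonZero d}} → (m + n % d) % d ≡ (m + n) % d
[m+n%d]%d≡[m+n]%d m n d = begin
  (m + n % d) % d                   ≡⟨ %-distribˡ-+ m (n % d) d ⟩
  (m % d + n % d % d) % d           ≡⟨ cong (λ r → (m % d + r) % d) (m%n%n≡m%n n d) ⟩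
  (m % d + n % d) % d               ≡⟨ %-distribˡ-+ m n d ⟨
  (m + n) % d                       ∎
  where open ≡-Reasoning

+ₙ-identityˡ : ∀ {n} (r : Fin (suc n)) → zero +ₙ r ≡ r
+ₙ-identityˡ r = toℕ-injective (trans (toℕ-fromℕ< _) (m<n⇒m%n≡m (toℕ<n r)))

a+ₙ[k-ₙa]≡k : ∀ {n} (a k : Fin n) → a +ₙ (k -ₙ a) ≡ k
a+ₙ[k-ₙa]≡k {suc n} a k = toℕ-injective (begin
  toℕ (a +ₙ (k -ₙ a))                 ≡⟨ toℕ-fromℕ< _ ⟩
  (α + toℕ (k -ₙ a)) % N              ≡⟨ cong (λ r → (α + r) % N) (toℕ-fromℕ< _) ⟩
  (α + (N ∸ α + κ) % N) % N           ≡⟨ [m+n%d]%d≡[m+n]%d α (N ∸ α + κ) N ⟩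
  (α + (N ∸ α + κ)) % N               ≡⟨ cong (_% N) (+-assoc α (N ∸ α) κ) ⟨
  (α + (N ∸ α) + κ) % N               ≡⟨ cong (λ r → (r + κ) % N) (m+[n∸m]≡n (<⇒≤ (toℕ<n a))) ⟩
  (N + κ) % N                         ≡⟨ %-remove-+ˡ κ (∣-refl {N}) ⟩
  κ % N                               ≡⟨ m<n⇒m%n≡m (toℕ<n k) ⟩
  κ                                   ∎)
  where
  open ≡-Reasoning
  N = suc n
  α = toℕ a
  κ = toℕ k

∃-outsideImage : {g : Fin b → Fin K} → Injective _≡_ _≡_ g → (h : Fin a → Fin K) → a < b →
  ∃ λ c → ∀ i → h i ≢ g c
∃-outsideImage {g = g} g-injective h a<b with any? (λ c → all? (λ i → ¬? (h i ≟ g c)))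
... | yes avoided = avoided
... | no  never   = contradiction (injective⇒≤ preimage-injective) (<⇒≱ a<b)
  where
  preimage : ∀ c → ∃ λ i → h i ≡ g c
  preimage c with any? (λ i → h i ≟ g c)
  ... | yes hit = hit
  ... | no  miss = contradiction (c , λ i e → miss (i , e)) never
  preimage-injective : Injective _≡_ _≡_ (proj₁ ∘ preimage)
  preimage-injective {c} {c′} e =
    g-injective (trans (sym (proj₂ (preimage c))) (trans (cong h e) (proj₂ (preimage c′))))

∷-injective : ∀ {x} {xs : Fin a → A} → (∀ i → xs i ≢ x) → Injective _≡_ _≡_ xs → Injective _≡_ _≡_ (x ∷ xs)
∷-injective x∉xs xs-injective {zero}  {zero}  _ = refl
∷-injective x∉xs xs-injective {zero}  {suc j} e = contradiction (sym e) (x∉xs j)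
∷-injective x∉xs xs-injective {suc i} {zero}  e = contradiction e (x∉xs i)
∷-injective x∉xs xs-injective {suc i} {suc j} e = cong suc (xs-injective e)

InjectiveExcept : Fin K → (Fin K → A) → Set
InjectiveExcept u φ = ∀ {v v′} → v ≢ u → v′ ≢ u → φ v ≡ φ v′ → v ≡ v′

injective⇒injectiveExcept : ∀ {u} {φ : Fin K → A} → Injective _≡_ _≡_ φ → InjectiveExcept u φ
injective⇒injectiveExcept φ-injective _ _ = φ-injective

injectiveExcept-zero : {φ : Fin (suc K) → A} → Injective _≡_ _≡_ (φ ∘ suc) → InjectiveExcept zero φ
injectiveExcept-zero _ {zero}  v≢0 _ _ = contradiction refl v≢0
injectiveExcept-zero _ {suc _} {zero} _ v′≢0 _ = contradiction refl v′≢0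
injectiveExcept-zero φsuc-injective {suc _} {suc _} _ _ e = cong suc (φsuc-injective e)

injectiveExcept-fill : ∀ {u} {φ ψ : Fin K → A} → InjectiveExcept u φ →
  (∀ v → v ≢ u → ψ v ≡ φ v) → (∀ v → v ≢ u → ψ u ≢ φ v) → Injective _≡_ _≡_ ψ
injectiveExcept-fill {u = u} φ-inj ψ≗φ ψu-new {v} {v′} e with v ≟ u | v′ ≟ u
... | yes refl | yes refl = refl
... | yes refl | no v′≢u  = contradiction (trans e (ψ≗φ v′ v′≢u)) (ψu-new v′ v′≢u)
... | no v≢u   | yes refl = contradiction (trans (sym e) (ψ≗φ v v≢u)) (ψu-new v v≢u)
... | no v≢u   | no v′≢u  = φ-inj v≢u v′≢u (trans (sym (ψ≗φ v v≢u)) (trans e (ψ≗φ v′ v′≢u)))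

injectiveExcept-move : ∀ {u u′} {φ ψ : Fin K → A} → InjectiveExcept u φ → u′ ≢ u →
  (∀ v → v ≢ u → ψ v ≡ φ v) → ψ u ≡ φ u′ → InjectiveExcept u′ ψ
injectiveExcept-move {u = u} {u′} φ-inj u′≢u ψ≗φ ψu≡φu′ {v} {v′} v≢u′ v′≢u′ e with v ≟ u | v′ ≟ u
... | yes refl | yes refl = refl
... | yes refl | no v′≢u  =
  contradiction (sym (φ-inj u′≢u v′≢u (trans (sym ψu≡φu′) (trans e (ψ≗φ v′ v′≢u))))) v′≢u′
... | no v≢u   | yes refl =
  contradiction (sym (φ-inj u′≢u v≢u (trans (sym ψu≡φu′) (trans (sym e) (ψ≗φ v v≢u))))) v≢u′
... | no v≢u   | no v′≢u  = φ-inj v≢u v′≢u (trans (sym (ψ≗φ v v≢u)) (trans e (ψ≗φ v′ v′≢u)))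

-- G c is the c-th of m matchings of the colours Fin k into the rows Fin n; a rainbow matching
-- matches every colour through a different one of them, hitting distinct rows.
record RainbowMatching {m k n} (G : Fin m → Fin k → Fin n) : Set where
  field
    column           : Fin k → Fin m
    column-injective : Injective _≡_ _≡_ column
    row-injective    : Injective _≡_ _≡_ (λ v → G (column v) v)

-- Extending the rainbow matching `old` of the colours suc z to colour zero.  The search tree has
-- as nodes colour zero and the old colours visited so far, and for each node a rainbow matching
-- of all other colours that uses only old rows and only columns in `used`.  A column j outside
-- `used` is injective on the t + 1 nodes, so it sends some node a to a row that is not the old row
-- of a visited colour.  If that row is new, j fills the hole at a; otherwise it is the old row of
-- an unvisited colour z, which becomes a node by giving a the column j.  At most k colours can be
-- visited, and 2k < m guarantees a fresh column at each step.
module Augmentation {m k n} (G : Fin m → Fin (suc k) → Fin n)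
                    (G-injective : ∀ c → Injective _≡_ _≡_ (G c))
                    (old : RainbowMatching (λ c z → G c (suc z)))
                    (k+k<m : k + k < m) where

  open RainbowMatching old renaming
    (column to oldColumn; column-injective to oldColumn-injective; row-injective to oldRow-injective)

  oldRow : Fin k → Fin n
  oldRow z = G (oldColumn z) (suc z)

  row : (Fin (suc k) → Fin m) → Fin (suc k) → Fin n
  row column v = G (column v) v

  nodes : (Fin t → Fin k) → Fin (suc t) → Fin (suc k)
  nodes visited = zero ∷ (suc ∘ visited)

  unvisited-notNode : ∀ {visited : Fin t → Fin k} {z} → (∀ i → visited i ≢ z) → ∀ a → suc z ≢ nodes visited a
  unvisited-notNode z-unvisited zero    ()
  unvisited-notNode z-unvisited (suc i) e = z-unvisited i (sym (Fin-suc-injective e))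

  record HoleMatching (visited : Fin t → Fin k) (used : Fin (t + k) → Fin m) (hole : Fin (suc k)) : Set where
    field
      column           : Fin (suc k) → Fin m
      column-injective : InjectiveExcept hole column
      row-injective    : InjectiveExcept hole (row column)
      row-old          : ∀ v → v ≢ hole → ∃ λ z → row column v ≡ oldRow z
      column-used      : ∀ v → v ≢ hole → ∃ λ i → column v ≡ used i
      unvisited-old    : ∀ z → (∀ i → visited i ≢ z) → column (suc z) ≡ oldColumn z

    assign : Fin m → Fin (suc k) → Fin m
    assign j = updateAt column hole (const j)

    assign-hole : ∀ j → assign j hole ≡ j
    assign-hole j = updateAt-updates hole column

    assign-other : ∀ j v → v ≢ hole → assign j v ≡ column v
    assign-other j v v≢hole = updateAt-minimal v hole column v≢hole

    assign-injective : ∀ {j} → (∀ i → used i ≢ j) → Injective _≡_ _≡_ (assign j)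
    assign-injective j-unused = injectiveExcept-fill column-injective (assign-other _)
      λ v v≢hole assigned≡ → let (i , e) = column-used v v≢hole in
        j-unused i (trans (sym e) (trans (sym assigned≡) (assign-hole _)))

    row-assign-hole : ∀ j → row (assign j) hole ≡ G j hole
    row-assign-hole j = cong (λ c → G c hole) (assign-hole j)

    row-assign-other : ∀ j v → v ≢ hole → row (assign j) v ≡ row column v
    row-assign-other j v v≢hole = cong (λ c → G c v) (assign-other j v v≢hole)

  open HoleMatching

  fillHole : ∀ {visited : Fin t → Fin k} {used hole} → HoleMatching visited used hole → ∀ {j} →
    (∀ i → used i ≢ j) → (∀ z → oldRow z ≢ G j hole) → RainbowMatching G
  fillHole {hole = hole} H {j} j-unused row-new = record
    { column           = assign H j
    ; column-injective = assign-injective H j-unused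
    ; row-injective    = injectiveExcept-fill (row-injective H) (row-assign-other H j)
        λ v v≢hole e → let (z , old≡) = row-old H v v≢hole in
          row-new z (trans (sym old≡) (trans (sym e) (row-assign-hole H j)))
    }

  moveHole : ∀ {visited : Fin t → Fin k} {used} a → HoleMatching visited used (nodes visited a) →
    ∀ {j z} → (∀ i → used i ≢ j) → (∀ i → visited i ≢ z) → G j (nodes visited a) ≡ oldRow z →
    HoleMatching (z ∷ visited) (j ∷ used) (suc z)
  moveHole {visited = visited} a H {j} {z} j-unused z-unvisited hit = record
    { column           = assign H j
    ; column-injective = injective⇒injectiveExcept (assign-injective H j-unused)
    ; row-injective    = injectiveExcept-move (row-injective H) (unvisited-notNode z-unvisited a)
        (row-assign-other H j)
        (trans (row-assign-hole H j) (trans hit (cong (λ c → G c (suc z)) (sym (unvisited-old H z z-unvisited)))))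
    ; row-old          = row-old′
    ; column-used      = column-used′
    ; unvisited-old    = λ z′ z′-unvisited →
        trans (assign-other H j (suc z′) (unvisited-notNode (z′-unvisited ∘ suc) a))
              (unvisited-old H z′ (z′-unvisited ∘ suc))
    }
    where
    hole = nodes visited a
    row-old′ : ∀ v → v ≢ suc z → ∃ λ z′ → row (assign H j) v ≡ oldRow z′
    row-old′ v _ with v ≟ hole
    ... | yes refl  = z , trans (row-assign-hole H j) hit
    ... | no v≢hole = let (z′ , e) = row-old H v v≢hole in z′ , trans (row-assign-other H j v v≢hole) e
    column-used′ : ∀ v → v ≢ suc z → ∃ λ i → assign H j v ≡ (j ∷ _) i
    column-used′ v _ with v ≟ hole
    ... | yes refl  = zero , assign-hole H j
    ... | no v≢hole = let (i , e) = column-used H v v≢hole in suc i , trans (assign-other H j v v≢hole) e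

  extendHistory : ∀ {visited : Fin t → Fin k} {used hole} z j →
    HoleMatching visited used hole → HoleMatching (z ∷ visited) (j ∷ used) hole
  extendHistory z j H = record
    { column           = column H
    ; column-injective = column-injective H
    ; row-injective    = row-injective H
    ; row-old          = row-old H
    ; column-used      = λ v v≢hole → let (i , e) = column-used H v v≢hole in suc i , e
    ; unvisited-old    = λ z′ z′-unvisited → unvisited-old H z′ (z′-unvisited ∘ suc)
    }

  record SearchState (t : ℕ) : Set where
    field
      visited           : Fin t → Fin k
      visited-injective : Injective _≡_ _≡_ visited
      used              : Fin (t + k) → Fin m
      holeMatching      : ∀ a → HoleMatching visited used (nodes visited a)

  initial : SearchState 0
  initial = record
    { visited           = λ ()
    ; visited-injective = λ { {()} }
    ; used              = oldColumn
    ; holeMatching      = λ { zero → start }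
    }
    where
    start : HoleMatching (λ ()) oldColumn zero
    start = record
      { column           = fromℕ< (≤-<-trans z≤n k+k<m) ∷ oldColumn
      ; column-injective = injectiveExcept-zero oldColumn-injective
      ; row-injective    = injectiveExcept-zero oldRow-injective
      ; row-old          = λ { zero 0≢0 → contradiction refl 0≢0 ; (suc z) _ → z , refl }
      ; column-used      = λ { zero 0≢0 → contradiction refl 0≢0 ; (suc z) _ → z , refl }
      ; unvisited-old    = λ _ _ → refl
      }

  module _ (S : SearchState t) where
    open SearchState S

    extend : ∀ {j} → (∀ i → used i ≢ j) → ∀ a {z} → (∀ i → visited i ≢ z) →
      G j (nodes visited a) ≡ oldRow z → SearchState (suc t)
    extend {j} j-unused a {z} z-unvisited hit = record
      { visited           = z ∷ visited
      ; visited-injective = ∷-injective z-unvisited visited-injective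
      ; used              = j ∷ used
      ; holeMatching      = λ where
          zero          → extendHistory z j (holeMatching zero)
          (suc zero)    → moveHole a (holeMatching a) j-unused z-unvisited hit
          (suc (suc i)) → extendHistory z j (holeMatching (suc i))
      }

    nodes-injective : Injective _≡_ _≡_ (nodes visited)
    nodes-injective = ∷-injective (λ _ ()) (visited-injective ∘ Fin-suc-injective)

    step : t ≤ k → RainbowMatching G ⊎ SearchState (suc t)
    step t≤k with ∃-outsideImage id used (≤-<-trans (+-monoˡ-≤ k t≤k) k+k<m)
    ... | j , j-unused with ∃-outsideImage (nodes-injective ∘ G-injective j) (oldRow ∘ visited) (n<1+n t)
    ... | a , a-new with any? (λ z → oldRow z ≟ G j (nodes visited a))
    ... | no  new        = inj₁ (fillHole (holeMatching a) j-unused (λ z e → new (z , e)))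
    ... | yes (z , old≡) = inj₂ (extend j-unused a (λ i e → a-new i (trans (cong oldRow e) old≡)) (sym old≡))

  search : ∀ d → d + t ≡ suc k → SearchState t → RainbowMatching G
  search zero    refl S = ⊥-elim (<⇒notInjective (n<1+n k) (SearchState.visited-injective S))
  search {t} (suc d) eq S with step S (subst (t ≤_) (suc-injective eq) (m≤n+m t d))
  ... | inj₁ done = done
  ... | inj₂ S′   = search d (trans (+-suc d t) eq) S′

  augment : RainbowMatching G
  augment = search (suc k) (+-identityʳ (suc k)) initial

-- Drisko's theorem, for 2k − 1 matchings that all saturate the colours.
rainbowMatching : ∀ {m k n} → k + k ≤ suc m → (G : Fin m → Fin k → Fin n) →
  (∀ c → Injective _≡_ _≡_ (G c)) → RainbowMatching G
rainbowMatching {k = zero} _ G _ = record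
  { column = λ () ; column-injective = λ { {()} } ; row-injective = λ { {()} } }
rainbowMatching {m} {suc k} bound G G-injective =
  Augmentation.augment G G-injective
    (rainbowMatching (m≤n⇒m≤1+n (<⇒≤ k+k<m)) (λ c → G c ∘ suc) (λ c → Fin-suc-injective ∘ G-injective c))
    k+k<m
  where
  k+k<m : k + k < m
  k+k<m = subst (_≤ m) (+-suc k k) (s≤s⁻¹ bound)

_≟ᵥ_ : ∀ {n} (u v : ChessVertex n) → Dec (u ≡ v)
_≟ᵥ_ = ≡-dec _≟_ _≟_

module RookLift {n} (f : ChessVertex n → Fin n) (τ : Fin n → ChessVertex n) (f∘τ≗id : ∀ k → f (τ k) ≡ k)
                (τ-rows-injective : Injective _≡_ _≡_ (proj₁ ∘ τ))
                (τ-columns-injective : Injective _≡_ _≡_ (proj₂ ∘ τ))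
                (y : SimplexPoint n) where

  open SimplexPoint y using () renaming (coord to yc)

  lift : ChessVertex n → ℚ
  lift v = if does (τ (f v) ≟ᵥ v) then yc (f v) else 0ℚ

  lift-nonneg : ∀ v → 0ℚ ℚ.≤ lift v
  lift-nonneg v with τ (f v) ≟ᵥ v
  ... | yes _ = SimplexPoint.nonneg y (f v)
  ... | no  _ = ℚₚ.≤-refl

  lift-τ : ∀ k → lift (τ k) ≡ yc k
  lift-τ k with τ (f (τ k)) ≟ᵥ τ k
  ... | yes _  = cong yc (f∘τ≗id k)
  ... | no  ne = contradiction (cong τ (f∘τ≗id k)) ne

  realize-lift : ∀ k → realize f lift k ≡ yc k
  realize-lift k = trans (sumChess-single _ (τ k) off) at
    where
    off : ∀ u → u ≢ τ k → (if does (f u ≟ k) then lift u else 0ℚ) ≡ 0ℚ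
    off u u≢τk with f u ≟ k
    ... | no  _    = refl
    ... | yes refl with τ (f u) ≟ᵥ u
    ...   | yes τfu≡u = contradiction (sym τfu≡u) u≢τk
    ...   | no  _     = refl
    at : (if does (f (τ k) ≟ k) then lift (τ k) else 0ℚ) ≡ yc k
    at with f (τ k) ≟ k
    ... | yes _  = lift-τ k
    ... | no  ne = contradiction (f∘τ≗id k) ne

  placement : List (ChessVertex n)
  placement = map τ (allFin n)

  placement-face : IsChessFace placement
  placement-face u∈ v∈ u≢v with ∈-map⁻ τ u∈ | ∈-map⁻ τ v∈
  ... | k , _ , refl | l , _ , refl =
    (u≢v ∘ cong τ ∘ τ-rows-injective) , (u≢v ∘ cong τ ∘ τ-columns-injective)

  lift-support : ∀ v → ¬ lift v ≡ 0ℚ → v ∈ placement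
  lift-support v lift≢0 with τ (f v) ≟ᵥ v
  ... | yes τfv≡v = subst (_∈ placement) τfv≡v (∈-map⁺ τ (∈-allFin (f v)))
  ... | no  _     = contradiction refl lift≢0

  liftPoint : ChessPoint n
  liftPoint = record
    { coord   = lift
    ; nonneg  = lift-nonneg
    ; sum1    = trans (sym (sumFin-realize f lift)) (trans (sumFin-cong realize-lift) (SimplexPoint.sum1 y))
    ; carrier = placement
    ; face    = placement-face
    ; support = lift-support
    }

rookPlacement⇒surjectiveRealization : ∀ {n} (f : ChessVertex n → Fin n) (τ : Fin n → ChessVertex n) →
  (∀ k → f (τ k) ≡ k) → Injective _≡_ _≡_ (proj₁ ∘ τ) → Injective _≡_ _≡_ (proj₂ ∘ τ) →
  IsSurjectiveRealization f
rookPlacement⇒surjectiveRealization f τ f∘τ≗id rows-injective columns-injective y =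
  liftPoint , realize-lift
  where open RookLift f τ f∘τ≗id rows-injective columns-injective y

module EquivariantColumns {n} {f : ChessVertex (suc n) → Fin (suc n)} (equivariant : IsEquivariant f) where

  equivariant-shift : ∀ r c → f (r , c) ≡ f (zero , c) +ₙ r
  equivariant-shift r c = trans (cong (λ i → f (i , c)) (sym (+ₙ-identityˡ r))) (equivariant r (zero , c))

  rowOf : Fin (Cols (suc n)) → Fin (suc n) → Fin (suc n)
  rowOf c k = k -ₙ f (zero , c)

  f-rowOf : ∀ c k → f (rowOf c k , c) ≡ k
  f-rowOf c k = trans (equivariant-shift (rowOf c k) c) (a+ₙ[k-ₙa]≡k (f (zero , c)) k)

  rowOf-injective : ∀ c → Injective _≡_ _≡_ (rowOf c)
  rowOf-injective c {k} {l} e = trans (sym (f-rowOf c k)) (trans (cong (λ r → f (r , c)) e) (f-rowOf c l))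

enoughColumns : ∀ n → suc n + suc n ≤ suc (Cols (suc n))
enoughColumns n = ≤-reflexive (cong (suc n +_) (sym (+-identityʳ (suc n))))

theorem5p6 : (n : ℕ) → 2 ≤ n → (f : ChessVertex n → Fin n) →
    IsSimplicial f → IsEquivariant f → IsSurjectiveRealization f
-- Every vertex map into the full simplex is simplicial, so only equivariance is used.
theorem5p6 (suc n) _ f _ equivariant =
  rookPlacement⇒surjectiveRealization f τ (λ k → f-rowOf (column k) k) row-injective column-injective
  where
  open EquivariantColumns {f = f} equivariant
  open RainbowMatching (rainbowMatching (enoughColumns n) rowOf rowOf-injective)
  τ : Fin (suc n) → ChessVertex (suc n)
  τ k = rowOf (column k) k , column k
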